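{- If $G$ is a connected $(n-2)$-regular graph of order $n$, then $G$ is $4$-$\gamma_{tR}$-edge-critical.
   Context: All graphs are finite and simple. For a graph $G$ with no isolated vertices, a total Roman dominating function is a map $f:V(G)\to\{0,1,2\}$ such that every vertex with $f(v)=0$ is adjacent to a vertex $u$ with $f(u)=2$, and the subgraph induced by $\{v:f(v)>0\}$ has no isolated vertices; $\gamma_{tR}(G)$ is the minimum of $\sum_v f(v)$ over such $f$. $G$ is $k$-$\gamma_{tR}$-edge-critical if $\gamma_{tR}(G)=k$, $E(\overline{G})\neq\emptyset$ and $\gamma_{tR}(G+e)<\gamma_{tR}(G)$ for every $e\in E(\overline{G})$. -}

module Defs where

open import Data.Nat using (ℕ; _<_; _≤_; _+_)
open import Data.Fin using (Fin; toℕ)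
open import Data.Fin.Properties using (_≟_)
open import Data.Bool using (Bool; true; false; if_then_else_; _∨_; _∧_)
open import Data.List using (List; map; allFin)
open import Data.Nat.ListAction using (sum)
open import Data.Product using (Σ; _×_; ∃; ∃-syntax)
open import Relation.Binary.PropositionalEquality using (_≡_; _≢_)
open import Relation.Nullary using (¬_; ⌊_⌋)

Graph : ℕ → Set
Graph n = Fin n → Fin n → Bool

IsSimple : ∀ {n} → Graph n → Set
IsSimple {n} G = (∀ (u v : Fin n) → G u v ≡ G v u) × (∀ (v : Fin n) → G v v ≡ false)

Adj : ∀ {n} → Graph n → Fin n → Fin n → Set
Adj G u v = G u v ≡ true

degree : ∀ {n} → Graph n → Fin n → ℕ
degree {n} G v = sum (map (λ w → if G v w then 1 else 0) (allFin n))

Regular : ∀ {n} → ℕ → Graph n → Set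
Regular {n} r G = ∀ (v : Fin n) → degree G v ≡ r

data Walk {n} (G : Graph n) : Fin n → Fin n → Set where
  here : ∀ {v} → Walk G v v
  step : ∀ {u v w} → Adj G u v → Walk G v w → Walk G u w

Connected : ∀ {n} → Graph n → Set
Connected {n} G = ∀ (u v : Fin n) → Walk G u v

addEdge : ∀ {n} → Graph n → Fin n → Fin n → Graph n
addEdge G u v x y =
  G x y ∨ ((⌊ x ≟ u ⌋ ∧ ⌊ y ≟ v ⌋) ∨ (⌊ x ≟ v ⌋ ∧ ⌊ y ≟ u ⌋))

IsNonEdge : ∀ {n} → Graph n → Fin n → Fin n → Set
IsNonEdge G u v = (u ≢ v) × (G u v ≡ false)

Labelling : ℕ → Set
Labelling n = Fin n → Fin 3

weight : ∀ {n} → Labelling n → ℕ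
weight {n} f = sum (map (λ v → toℕ (f v)) (allFin n))

IsTRDF : ∀ {n} → Graph n → Labelling n → Set
IsTRDF {n} G f =
  (∀ (v : Fin n) → toℕ (f v) ≡ 0 → ∃[ u ] (Adj G v u × toℕ (f u) ≡ 2))
  × (∀ (v : Fin n) → 0 < toℕ (f v) → ∃[ u ] (Adj G v u × 0 < toℕ (f u)))

HasγtR : ∀ {n} → Graph n → ℕ → Set
HasγtR {n} G k =
  (∃[ f ] (IsTRDF G f × weight f ≡ k))
  × (∀ (f : Labelling n) → IsTRDF G f → k ≤ weight f)

EdgeCritical : ∀ {n} → ℕ → Graph n → Set
EdgeCritical {n} k G =
  HasγtR G k
  × (∃[ u ] ∃[ v ] IsNonEdge G u v)
  × (∀ (u v : Fin n) → IsNonEdge G u v →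
       ∃[ k' ] (HasγtR (addEdge G u v) k' × k' < k))

-- In an (n − 2)-regular graph of order n every vertex has exactly one
-- non-neighbour besides itself, so any two distinct vertices together dominate
-- all others.  Labelling the ends of an edge with 2 therefore gives a TRDF of
-- weight 4, and in G + ab the labelling a ↦ 2, b ↦ 1 gives weight 3.
-- Conversely, a TRDF without a 2 is positive everywhere and weighs at least
-- n ≥ 4, while a 2 at x forces weight 4 in G: the non-neighbour of x is either
-- positive (besides x and a positive neighbour of x) or dominated by a second 2.
-- In G + ab a 2 and its positive neighbour already weigh 3.
module Submission where

open import Defs
open import Data.Nat using (ℕ; _≤_; _∸_; _<_; zero; suc; _+_; z≤n; s≤s)
import Data.Nat as ℕ
open import Data.Nat.Properties
  using ( +-0-commutativeMonoid; +-identityʳ; +-assoc; +-comm; +-cancelˡ-≡; 1+n≢n; 1+n≰n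
        ; n≢0⇒n>0; <⇒≢; ≤-refl; ≤-reflexive; ≤-trans; n≤1+n; m≤m+n; +-mono-≤; +-monoʳ-≤
        ; module ≤-Reasoning )
open import Data.Fin using (Fin; zero; suc; punchIn; toℕ)
open import Data.Fin.Patterns using (1F; 2F)
open import Data.Fin.Properties using (punchInᵢ≢i; _≟_; any?)
open import Data.Bool using (Bool; true; false; if_then_else_; not; _∨_)
import Data.Bool as Bool
open import Data.Bool.Properties using (∨-zeroʳ)
open import Data.List using (tabulate; allFin; map)
open import Data.List.Properties using (map-tabulate)
import Data.Nat.ListAction as List
open import Data.Vec.Functional using (updateAt; removeAt)
open import Data.Vec.Functional.Properties using (updateAt-updates; updateAt-minimal)
open import Data.Product using (_×_; _,_; proj₁; proj₂; ∃-syntax)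
open import Data.Sum using (_⊎_; inj₁; inj₂)
open import Data.Empty using (⊥-elim)
open import Function using (const; id; _∘_)
open import Relation.Nullary using (yes; no; ¬?)
open import Relation.Nullary.Decidable using (_×-dec_)
open import Relation.Binary.PropositionalEquality
open import Algebra.Properties.CommutativeMonoid.Sum +-0-commutativeMonoid
  using (sum-remove; ∑-distrib-+; sum-cong-≗; sum-replicate-zero) renaming (sum to ∑)

listSum-tabulate : ∀ {n} (t : Fin n → ℕ) → List.sum (tabulate t) ≡ ∑ t
listSum-tabulate {zero}  t = refl
listSum-tabulate {suc n} t = cong (t zero +_) (listSum-tabulate (t ∘ suc))

listSum-allFin : ∀ {n} (t : Fin n → ℕ) → List.sum (map t (allFin n)) ≡ ∑ t
listSum-allFin t = trans (cong List.sum (map-tabulate id t)) (listSum-tabulate t)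

∑-zero : ∀ {n} (t : Fin n → ℕ) → (∀ i → t i ≡ 0) → ∑ t ≡ 0
∑-zero {n} t t≗0 = trans (sum-cong-≗ t≗0) (sum-replicate-zero n)

∑-pick : ∀ {n} (t : Fin n → ℕ) (i : Fin n) → ∑ t ≡ t i + ∑ (updateAt t i (const 0))
∑-pick {suc n} t i = begin
  ∑ t                              ≡⟨ sum-remove t ⟩
  t i + ∑ (removeAt t i)           ≡⟨ cong (t i +_) (sum-cong-≗ λ j →
                                        sym (updateAt-minimal (punchIn i j) i t (punchInᵢ≢i i j))) ⟩
  t i + ∑ (removeAt t′ i)          ≡⟨ cong (t i +_) (cong (_+ ∑ (removeAt t′ i)) (updateAt-updates i t)) ⟨
  t i + (t′ i + ∑ (removeAt t′ i)) ≡⟨ cong (t i +_) (sum-remove t′) ⟨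
  t i + ∑ t′                       ∎
  where
  open ≡-Reasoning
  t′ = updateAt t i (const 0)

∑-single : ∀ {n} (t : Fin n → ℕ) (i : Fin n) → (∀ j → j ≢ i → t j ≡ 0) → ∑ t ≡ t i
∑-single t i t≡0 = begin
  ∑ t                             ≡⟨ ∑-pick t i ⟩
  t i + ∑ (updateAt t i (const 0)) ≡⟨ cong (t i +_) (∑-zero _ updateAt-zero-elsewhere) ⟩
  t i + 0                         ≡⟨ +-identityʳ (t i) ⟩
  t i                             ∎
  where
  open ≡-Reasoning
  updateAt-zero-elsewhere : ∀ j → updateAt t i (const 0) j ≡ 0
  updateAt-zero-elsewhere j with j ≟ i
  ... | yes refl = updateAt-updates i t
  ... | no j≢i   = trans (updateAt-minimal j i t j≢i) (t≡0 j j≢i)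

∑-pair : ∀ {n} (t : Fin n → ℕ) {i j : Fin n} → i ≢ j → (∀ k → k ≢ i → k ≢ j → t k ≡ 0) →
         ∑ t ≡ t i + t j
∑-pair t {i} {j} i≢j t≡0 = begin
  ∑ t               ≡⟨ ∑-pick t i ⟩
  t i + ∑ t′        ≡⟨ cong (t i +_) (∑-single t′ j t′≡0) ⟩
  t i + t′ j        ≡⟨ cong (t i +_) (updateAt-minimal j i t (i≢j ∘ sym)) ⟩
  t i + t j         ∎
  where
  open ≡-Reasoning
  t′ = updateAt t i (const 0)
  t′≡0 : ∀ k → k ≢ j → t′ k ≡ 0
  t′≡0 k k≢j with k ≟ i
  ... | yes refl = updateAt-updates i t
  ... | no k≢i   = trans (updateAt-minimal k i t k≢i) (t≡0 k k≢i k≢j)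

∑-≥-point : ∀ {n} (t : Fin n → ℕ) (i : Fin n) → t i ≤ ∑ t
∑-≥-point t i = subst (t i ≤_) (sym (∑-pick t i)) (m≤m+n (t i) _)

∑-≥-pair : ∀ {n} (t : Fin n → ℕ) {i j : Fin n} → i ≢ j → t i + t j ≤ ∑ t
∑-≥-pair t {i} {j} i≢j = begin
  t i + t j   ≡⟨ cong (t i +_) (updateAt-minimal j i t (i≢j ∘ sym)) ⟨
  t i + t′ j  ≤⟨ +-monoʳ-≤ (t i) (∑-≥-point t′ j) ⟩
  t i + ∑ t′  ≡⟨ ∑-pick t i ⟨
  ∑ t         ∎
  where
  open ≤-Reasoning
  t′ = updateAt t i (const 0)

∑-≥-triple : ∀ {n} (t : Fin n → ℕ) {i j k : Fin n} → i ≢ j → i ≢ k → j ≢ k →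
             t i + t j + t k ≤ ∑ t
∑-≥-triple t {i} {j} {k} i≢j i≢k j≢k = begin
  t i + t j + t k      ≡⟨ +-assoc (t i) (t j) (t k) ⟩
  t i + (t j + t k)    ≡⟨ cong₂ (λ a b → t i + (a + b)) (updateAt-minimal j i t (i≢j ∘ sym))
                                                      (updateAt-minimal k i t (i≢k ∘ sym)) ⟨
  t i + (t′ j + t′ k)  ≤⟨ +-monoʳ-≤ (t i) (∑-≥-pair t′ j≢k) ⟩
  t i + ∑ t′           ≡⟨ ∑-pick t i ⟨
  ∑ t                  ∎
  where
  open ≤-Reasoning
  t′ = updateAt t i (const 0)

∑-ones : ∀ {n} → ∑ {n} (const 1) ≡ n
∑-ones {zero}  = refl
∑-ones {suc n} = cong suc ∑-ones

∑-≥-size : ∀ {n} (t : Fin n → ℕ) → (∀ i → 1 ≤ t i) → n ≤ ∑ t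
∑-≥-size {zero}  t t≥1 = z≤n
∑-≥-size {suc n} t t≥1 = +-mono-≤ (t≥1 zero) (∑-≥-size (t ∘ suc) (t≥1 ∘ suc))

true≢false : true ≢ false
true≢false ()

module _ {n} (H : Graph n) where

  adjacent⇒≢ : (∀ v → H v v ≡ false) → ∀ {x y} → Adj H x y → x ≢ y
  adjacent⇒≢ irreflexive {x} Hxy refl = true≢false (trans (sym Hxy) (irreflexive x))

  neighbour≢nonNeighbour : ∀ {x y z} → Adj H x y → H x z ≡ false → y ≢ z
  neighbour≢nonNeighbour Hxy Hxz refl = true≢false (trans (sym Hxy) Hxz)

module _ {n} {H : Graph n} {f : Labelling n} (trdf : IsTRDF H f) where

  private
    value : Fin n → ℕ
    value w = toℕ (f w)

  weight≡∑ : weight f ≡ ∑ value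
  weight≡∑ = listSum-allFin value

  two-or-allPositive : (∃[ x ] value x ≡ 2) ⊎ (∀ w → 1 ≤ value w)
  two-or-allPositive with any? (λ x → value x ℕ.≟ 2)
  ... | yes two = inj₁ two
  ... | no ¬two = inj₂ λ w → n≢0⇒n>0 λ fw≡0 →
    let (u , _ , fu≡2) = proj₁ trdf w fw≡0 in ¬two (u , fu≡2)

  positiveNeighbour-of-two : ∀ {x} → value x ≡ 2 → ∃[ y ] (Adj H x y × 1 ≤ value y)
  positiveNeighbour-of-two {x} fx≡2 = proj₂ trdf x (subst (0 <_) (sym fx≡2) (s≤s z≤n))

  weight-≥-3 : (∀ v → H v v ≡ false) → 3 ≤ n → 3 ≤ weight f
  weight-≥-3 irreflexive 3≤n rewrite weight≡∑ with two-or-allPositive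
  ... | inj₂ positive = ≤-trans 3≤n (∑-≥-size value positive)
  ... | inj₁ (x , fx≡2) =
    let (y , Hxy , fy≥1) = positiveNeighbour-of-two fx≡2 in begin
      2 + 1             ≤⟨ +-mono-≤ (≤-reflexive (sym fx≡2)) fy≥1 ⟩
      value x + value y ≤⟨ ∑-≥-pair value (adjacent⇒≢ H irreflexive Hxy) ⟩
      ∑ value           ∎
    where open ≤-Reasoning

  weight-≥-4 : (∀ v → H v v ≡ false) → (∀ u v → H u v ≡ H v u) → 4 ≤ n →
               (∀ x → ∃[ m ] (m ≢ x × H x m ≡ false)) → 4 ≤ weight f
  weight-≥-4 irreflexive symmetric 4≤n nonNeighbour rewrite weight≡∑ with two-or-allPositive
  ... | inj₂ positive = ≤-trans 4≤n (∑-≥-size value positive)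
  ... | inj₁ (x , fx≡2) with nonNeighbour x
  ... | m , m≢x , Hxm with value m ℕ.≟ 0
  ...   | yes fm≡0 =
    let (z , Hmz , fz≡2) = proj₁ trdf m fm≡0 in begin
      2 + 2             ≡⟨ cong₂ _+_ fx≡2 fz≡2 ⟨
      value x + value z ≤⟨ ∑-≥-pair value (neighbour≢nonNeighbour H Hmz (trans (symmetric m x) Hxm) ∘ sym) ⟩
      ∑ value           ∎
    where open ≤-Reasoning
  ...   | no fm≢0 =
    let (y , Hxy , fy≥1) = positiveNeighbour-of-two fx≡2 in begin
      2 + 1 + 1                   ≤⟨ +-mono-≤ (+-mono-≤ (≤-reflexive (sym fx≡2)) fy≥1) (n≢0⇒n>0 fm≢0) ⟩
      value x + value y + value m ≤⟨ ∑-≥-triple value (adjacent⇒≢ H irreflexive Hxy) (m≢x ∘ sym)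
                                                     (neighbour≢nonNeighbour H Hxy Hxm) ⟩
      ∑ value                     ∎
    where open ≤-Reasoning

pairLabelling : ∀ {n} → Fin n → Fin 3 → Fin n → Fin 3 → Labelling n
pairLabelling x a y b = updateAt (updateAt (const zero) y (const b)) x (const a)

module _ {n} {x y : Fin n} {a b : Fin 3} (x≢y : x ≢ y) where

  private
    L = pairLabelling x a y b

  pairLabelling-at-x : L x ≡ a
  pairLabelling-at-x = updateAt-updates x _

  pairLabelling-at-y : L y ≡ b
  pairLabelling-at-y = trans (updateAt-minimal y x _ (x≢y ∘ sym)) (updateAt-updates y _)

  pairLabelling-elsewhere : ∀ {w} → w ≢ x → w ≢ y → L w ≡ zero
  pairLabelling-elsewhere {w} w≢x w≢y = trans (updateAt-minimal w x _ w≢x) (updateAt-minimal w y _ w≢y)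

  weight-pairLabelling : weight L ≡ toℕ a + toℕ b
  weight-pairLabelling = begin
    weight L               ≡⟨ listSum-allFin (toℕ ∘ L) ⟩
    ∑ (toℕ ∘ L)            ≡⟨ ∑-pair (toℕ ∘ L) x≢y (λ w w≢x w≢y → cong toℕ (pairLabelling-elsewhere w≢x w≢y)) ⟩
    toℕ (L x) + toℕ (L y)  ≡⟨ cong₂ (λ c d → toℕ c + toℕ d) pairLabelling-at-x pairLabelling-at-y ⟩
    toℕ a + toℕ b          ∎
    where open ≡-Reasoning

  pairLabelling-isTRDF : (H : Graph n) → Adj H x y → Adj H y x → 0 < toℕ a → 0 < toℕ b →
    (∀ w → w ≢ x → w ≢ y → ∃[ u ] (Adj H w u × toℕ (L u) ≡ 2)) → IsTRDF H L
  pairLabelling-isTRDF H Hxy Hyx a>0 b>0 dominated = dominated′ , total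
    where
    positive-at-x : 0 < toℕ (L x)
    positive-at-x = subst (λ c → 0 < toℕ c) (sym pairLabelling-at-x) a>0
    positive-at-y : 0 < toℕ (L y)
    positive-at-y = subst (λ c → 0 < toℕ c) (sym pairLabelling-at-y) b>0

    dominated′ : ∀ w → toℕ (L w) ≡ 0 → ∃[ u ] (Adj H w u × toℕ (L u) ≡ 2)
    dominated′ w Lw≡0 with w ≟ x | w ≟ y
    ... | yes refl | _        = ⊥-elim (<⇒≢ positive-at-x (sym Lw≡0))
    ... | no _     | yes refl = ⊥-elim (<⇒≢ positive-at-y (sym Lw≡0))
    ... | no w≢x   | no w≢y   = dominated w w≢x w≢y

    total : ∀ w → 0 < toℕ (L w) → ∃[ u ] (Adj H w u × 0 < toℕ (L u))
    total w Lw>0 with w ≟ x | w ≟ y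
    ... | yes refl | _        = y , Hxy , positive-at-y
    ... | no _     | yes refl = x , Hyx , positive-at-x
    ... | no w≢x   | no w≢y   = ⊥-elim (<⇒≢ Lw>0 (sym (cong toℕ (pairLabelling-elsewhere w≢x w≢y))))

module _ {n} (G : Graph n) {a b : Fin n} where

  private
    H = addEdge G a b

  addEdge-⊇ : ∀ {x y} → Adj G x y → Adj H x y
  addEdge-⊇ Gxy rewrite Gxy = refl

  addEdge-adds : Adj H a b
  addEdge-adds rewrite ≡-≟-identity _≟_ {a} refl | ≡-≟-identity _≟_ {b} refl = ∨-zeroʳ (G a b)

  addEdge-adds-sym : Adj H b a
  addEdge-adds-sym rewrite ≡-≟-identity _≟_ {a} refl | ≡-≟-identity _≟_ {b} refl =
    trans (cong (G b a ∨_) (∨-zeroʳ _)) (∨-zeroʳ (G b a))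

  addEdge-irreflexive : a ≢ b → ∀ {x} → G x x ≡ false → H x x ≡ false
  addEdge-irreflexive a≢b {x} Gxx rewrite Gxx with x ≟ a | x ≟ b
  ... | yes refl | yes refl = ⊥-elim (a≢b refl)
  ... | yes refl | no _     = refl
  ... | no _     | yes refl = refl
  ... | no _     | no _     = refl

walk-firstStep : ∀ {n} {G : Graph n} {x y} → Walk G x y → x ≢ y → ∃[ u ] Adj G x u
walk-firstStep here          x≢x = ⊥-elim (x≢x refl)
walk-firstStep (step Gxu _)  _   = _ , Gxu

boolToℕ : Bool → ℕ
boolToℕ b = if b then 1 else 0

boolToℕ-+-not : ∀ b → boolToℕ b + boolToℕ (not b) ≡ 1
boolToℕ-+-not true  = refl
boolToℕ-+-not false = refl

-- The (n − 2)-regular graphs of order n are the cocktail-party graphs: their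
-- complements are perfect matchings.
module CocktailParty {k} (G : Graph (2 + k)) (simple : IsSimple G) (regular : Regular k G) where

  private
    symmetric = proj₁ simple
    irreflexive = proj₂ simple

    nonAdjacency : Fin (2 + k) → Fin (2 + k) → ℕ
    nonAdjacency v w = boolToℕ (not (G v w))

  ∑-adjacency : ∀ v → ∑ (boolToℕ ∘ G v) ≡ k
  ∑-adjacency v = trans (sym (listSum-allFin (boolToℕ ∘ G v))) (regular v)

  ∑-nonAdjacency : ∀ v → ∑ (nonAdjacency v) ≡ 2
  ∑-nonAdjacency v = +-cancelˡ-≡ k _ 2 (begin
    k + ∑ (nonAdjacency v)                   ≡⟨ cong (_+ ∑ (nonAdjacency v)) (∑-adjacency v) ⟨
    ∑ (boolToℕ ∘ G v) + ∑ (nonAdjacency v)   ≡⟨ ∑-distrib-+ (boolToℕ ∘ G v) (nonAdjacency v) ⟨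
    ∑ (λ w → boolToℕ (G v w) + nonAdjacency v w) ≡⟨ sum-cong-≗ (boolToℕ-+-not ∘ G v) ⟩
    ∑ {2 + k} (const 1)                      ≡⟨ ∑-ones ⟩
    2 + k                                    ≡⟨ +-comm 2 k ⟩
    k + 2                                    ∎)
    where open ≡-Reasoning

  nonNeighbour-unique : ∀ v {x y} → x ≢ v → y ≢ v → G v x ≡ false → G v y ≡ false → x ≡ y
  nonNeighbour-unique v {x} {y} x≢v y≢v Gvx Gvy with x ≟ y
  ... | yes x≡y = x≡y
  ... | no x≢y  = ⊥-elim (1+n≰n (begin
    1 + 1 + 1                                              ≡⟨ cong₂ _+_ (cong₂ _+_ (nonAdjacent (irreflexive v)) (nonAdjacent Gvx))
                                                                        (nonAdjacent Gvy) ⟨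
    nonAdjacency v v + nonAdjacency v x + nonAdjacency v y ≤⟨ ∑-≥-triple (nonAdjacency v) (x≢v ∘ sym) (y≢v ∘ sym) x≢y ⟩
    ∑ (nonAdjacency v)                                     ≡⟨ ∑-nonAdjacency v ⟩
    2                                                      ∎))
    where
    open ≤-Reasoning
    nonAdjacent : ∀ {w} → G v w ≡ false → nonAdjacency v w ≡ 1
    nonAdjacent Gvw = cong (boolToℕ ∘ not) Gvw

  nonNeighbour : ∀ v → ∃[ m ] (m ≢ v × G v m ≡ false)
  nonNeighbour v with any? (λ m → ¬? (m ≟ v) ×-dec (G v m Bool.≟ false))
  ... | yes found = found
  ... | no none   = ⊥-elim (1+n≢n (begin
    2                  ≡⟨ ∑-nonAdjacency v ⟨
    ∑ (nonAdjacency v) ≡⟨ ∑-single (nonAdjacency v) v adjacentElsewhere ⟩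
    nonAdjacency v v   ≡⟨ cong (boolToℕ ∘ not) (irreflexive v) ⟩
    1                  ∎))
    where
    open ≡-Reasoning
    adjacentElsewhere : ∀ w → w ≢ v → nonAdjacency v w ≡ 0
    adjacentElsewhere w w≢v with G v w in Gvw
    ... | true  = refl
    ... | false = ⊥-elim (none (w , w≢v , Gvw))

  adjacent-to-one-of : ∀ w {x y} → x ≢ y → x ≢ w → y ≢ w → Adj G w x ⊎ Adj G w y
  adjacent-to-one-of w {x} {y} x≢y x≢w y≢w with G w x in Gwx | G w y in Gwy
  ... | true  | _     = inj₁ refl
  ... | false | true  = inj₂ refl
  ... | false | false = ⊥-elim (x≢y (nonNeighbour-unique w x≢w y≢w Gwx Gwy))

  adjacent-to-nonNeighbour-of-neighbour : ∀ {v u m} → Adj G v u → m ≢ u → G u m ≡ false → Adj G v m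
  adjacent-to-nonNeighbour-of-neighbour {v} {u} {m} Gvu m≢u Gum
    with adjacent-to-one-of m (adjacent⇒≢ G irreflexive Gvu) v≢m (m≢u ∘ sym)
    where v≢m = neighbour≢nonNeighbour G (trans (symmetric u v) Gvu) Gum
  ... | inj₁ Gmv = trans (symmetric v m) Gmv
  ... | inj₂ Gmu = ⊥-elim (true≢false (trans (sym Gmu) (trans (symmetric m u) Gum)))

  module _ (connected : Connected G) where

    neighbour : ∀ v → ∃[ u ] Adj G v u
    neighbour v = let (m , m≢v , _) = nonNeighbour v in walk-firstStep (connected v m) (m≢v ∘ sym)

    four≤order : 4 ≤ 2 + k
    four≤order = s≤s (s≤s (begin
      1 + 1                                  ≡⟨ cong₂ (λ p q → boolToℕ p + boolToℕ q) Gvu Gvm ⟨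
      boolToℕ (G v u) + boolToℕ (G v m)      ≤⟨ ∑-≥-pair (boolToℕ ∘ G v) (m≢u ∘ sym) ⟩
      ∑ (boolToℕ ∘ G v)                      ≡⟨ ∑-adjacency v ⟩
      k                                      ∎))
      where
      open ≤-Reasoning
      v = zero
      u = proj₁ (neighbour v)
      Gvu = proj₂ (neighbour v)
      m = proj₁ (nonNeighbour u)
      m≢u = proj₁ (proj₂ (nonNeighbour u))
      Gvm = adjacent-to-nonNeighbour-of-neighbour Gvu m≢u (proj₂ (proj₂ (nonNeighbour u)))

    γtR≡4 : HasγtR G 4
    γtR≡4 = (pairLabelling v 2F u 2F , isTRDF , weight-pairLabelling {a = 2F} {b = 2F} v≢u)
          , λ f trdf → weight-≥-4 trdf irreflexive symmetric four≤order nonNeighbour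
      where
      v = zero
      u = proj₁ (neighbour v)
      Gvu = proj₂ (neighbour v)
      v≢u = adjacent⇒≢ G irreflexive Gvu
      dominated : ∀ w → w ≢ v → w ≢ u → ∃[ x ] (Adj G w x × toℕ (pairLabelling v 2F u 2F x) ≡ 2)
      dominated w w≢v w≢u with adjacent-to-one-of w v≢u (w≢v ∘ sym) (w≢u ∘ sym)
      ... | inj₁ Gwv = v , Gwv , cong toℕ (pairLabelling-at-x {b = 2F} v≢u)
      ... | inj₂ Gwu = u , Gwu , cong toℕ (pairLabelling-at-y v≢u)
      isTRDF = pairLabelling-isTRDF v≢u G Gvu (trans (symmetric u v) Gvu) (s≤s z≤n) (s≤s z≤n) dominated

    addEdge-γtR≡3 : ∀ {a b} → IsNonEdge G a b → HasγtR (addEdge G a b) 3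
    addEdge-γtR≡3 {a} {b} (a≢b , Gab) = (pairLabelling a 2F b 1F , isTRDF , weight-pairLabelling {a = 2F} {b = 1F} a≢b)
      , λ f trdf → weight-≥-3 trdf (λ v → addEdge-irreflexive G a≢b (irreflexive v)) (≤-trans (n≤1+n 3) four≤order)
      where
      dominated : ∀ w → w ≢ a → w ≢ b → ∃[ x ] (Adj (addEdge G a b) w x × toℕ (pairLabelling a 2F b 1F x) ≡ 2)
      dominated w w≢a w≢b with adjacent-to-one-of a w≢b w≢a (a≢b ∘ sym)
      ... | inj₁ Gaw = a , addEdge-⊇ G (trans (symmetric w a) Gaw) , cong toℕ (pairLabelling-at-x a≢b)
      ... | inj₂ Gab′ = ⊥-elim (true≢false (trans (sym Gab′) Gab))
      isTRDF = pairLabelling-isTRDF a≢b (addEdge G a b) (addEdge-adds G) (addEdge-adds-sym G) (s≤s z≤n) (s≤s z≤n) dominated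

mainTheorem7 : (n : ℕ) → 2 ≤ n → (G : Graph n) → IsSimple G →
    Connected G → Regular (n ∸ 2) G → EdgeCritical 4 G
mainTheorem7 (suc (suc k)) (s≤s (s≤s _)) G simple connected regular =
    γtR≡4 connected
  , (let (m , m≢v , Gvm) = nonNeighbour zero in zero , m , m≢v ∘ sym , Gvm)
  , λ a b nonEdge → 3 , addEdge-γtR≡3 connected nonEdge , ≤-refl
  where open CocktailParty G simple regular
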